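{- Let $\mathcal M=\langle M,\in^{\mathcal M},X^{\mathcal M}\rangle$ be an $\mathcal L_X$-structure with $\mathcal M\models\mathrm{ZFC}(X)$. If $\mathcal N=\langle N,\in^{\mathcal N}\rangle$ is an $\mathcal L$-structure such that $\langle M,\in^{\mathcal M}\rangle\prec_{\mathrm{cf}}\mathcal N$, then there exists $X^{\mathcal N}$ with $X^{\mathcal M}\subseteq X^{\mathcal N}\subseteq N$ such that $\mathcal M\prec\langle N,\in^{\mathcal N},X^{\mathcal N}\rangle$.
   Context: $\mathcal{L}$ is the language with one binary relation $\in$, and $\mathcal L_X$ is $\mathcal L$ extended by a new unary predicate $X$. $\mathrm{ZFC}(X)$ is $\mathrm{ZFC}$ together with the separation and collection schemes for all $\mathcal L_X$-formulae. $\langle M,\in^{\mathcal M}\rangle\prec_{\mathrm{cf}}\mathcal N$ means $\mathcal N$ is an elementary extension of $\langle M,\in^{\mathcal M}\rangle$ and for every $x\in N$ there is $y\in M$ with $\mathcal N\models x\in y$. $\prec$ denotes elementary substructure (here in the language $\mathcal L_X$). -}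

module Defs where

open import Data.Nat using (ℕ; zero; suc)
open import Data.Fin using (Fin)
open import Data.Bool using (Bool; true; false)
open import Data.Empty using (⊥)
open import Data.Unit using (⊤)
open import Data.Product using (Σ; _×_; _,_)
open import Data.Sum using (_⊎_)
open import Relation.Nullary using (¬_)
open import Relation.Binary.PropositionalEquality using (_≡_)

-- Law of excluded middle (the metatheory of the paper is classical).
LEM : Set₁
LEM = (P : Set) → P ⊎ ¬ P

_⇔_ : Set → Set → Set
A ⇔ B = (A → B) × (B → A)

-- Assignments (de Bruijn variables: variable 0 is the most recently bound).
_∷ᵃ_ : {A : Set} {n : ℕ} → A → (Fin n → A) → (Fin (suc n) → A)
(a ∷ᵃ ρ) Fin.zero    = a
(a ∷ᵃ ρ) (Fin.suc i) = ρ i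

-- First-order formulas with n free variables.
-- Index b : Bool says whether the extra unary predicate X may occur:
-- Fm false n = L-formulas (language {∈}), Fm true n = L_X-formulas.
data Fm : Bool → ℕ → Set where
  _∈'_ : {b : Bool} {n : ℕ} → Fin n → Fin n → Fm b n
  _≐_  : {b : Bool} {n : ℕ} → Fin n → Fin n → Fm b n
  X'   : {n : ℕ} → Fin n → Fm true n
  ⊥'   : {b : Bool} {n : ℕ} → Fm b n
  _⇒_  : {b : Bool} {n : ℕ} → Fm b n → Fm b n → Fm b n
  _∧'_ : {b : Bool} {n : ℕ} → Fm b n → Fm b n → Fm b n
  _∨'_ : {b : Bool} {n : ℕ} → Fm b n → Fm b n → Fm b n
  ∀'   : {b : Bool} {n : ℕ} → Fm b (suc n) → Fm b n
  ∃'   : {b : Bool} {n : ℕ} → Fm b (suc n) → Fm b n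

-- An L-structure ⟨M, ∈^M⟩ (equality is interpreted as identity).
record LStr : Set₁ where
  field
    Carrier : Set
    mem     : Carrier → Carrier → Set
open LStr public

Sat : {b : Bool} {n : ℕ} (S : LStr) → (Carrier S → Set) → Fm b n → (Fin n → Carrier S) → Set
Sat S P (i ∈' j) ρ = mem S (ρ i) (ρ j)
Sat S P (i ≐ j)  ρ = ρ i ≡ ρ j
Sat S P (X' i)   ρ = P (ρ i)
Sat S P ⊥'       ρ = ⊥
Sat S P (φ ⇒ ψ)  ρ = Sat S P φ ρ → Sat S P ψ ρ
Sat S P (φ ∧' ψ) ρ = Sat S P φ ρ × Sat S P ψ ρ
Sat S P (φ ∨' ψ) ρ = Sat S P φ ρ ⊎ Sat S P ψ ρ
Sat S P (∀' φ)   ρ = (a : Carrier S) → Sat S P φ (a ∷ᵃ ρ)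
Sat S P (∃' φ)   ρ = Σ (Carrier S) (λ a → Sat S P φ (a ∷ᵃ ρ))

-- ZFC(X) axioms, written out as what satisfaction of the axioms unfolds to
-- in ⟨M, ∈, X⟩.
module _ (S : LStr) (X : Carrier S → Set) where
  private
    M = Carrier S
    _∈ₘ_ = mem S

  Extensionality : Set
  Extensionality = (x y : M) → ((z : M) → (z ∈ₘ x) ⇔ (z ∈ₘ y)) → x ≡ y

  Foundation : Set
  Foundation = (x : M) → Σ M (λ y → y ∈ₘ x) →
    Σ M (λ y → (y ∈ₘ x) × ((z : M) → z ∈ₘ y → ¬ (z ∈ₘ x)))

  Pairing : Set
  Pairing = (x y : M) → Σ M (λ p → (x ∈ₘ p) × (y ∈ₘ p))

  Union : Set
  Union = (x : M) → Σ M (λ u → (z y : M) → z ∈ₘ y → y ∈ₘ x → z ∈ₘ u)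

  PowerSet : Set
  PowerSet = (x : M) → Σ M (λ p → (z : M) → ((w : M) → w ∈ₘ z → w ∈ₘ x) → z ∈ₘ p)

  Infinity : Set
  Infinity = Σ M (λ y →
    Σ M (λ e → (e ∈ₘ y) × ((w : M) → ¬ (w ∈ₘ e))) ×
    ((u : M) → u ∈ₘ y → Σ M (λ v → (v ∈ₘ y) ×
       ((w : M) → (w ∈ₘ v) ⇔ ((w ∈ₘ u) ⊎ (w ≡ u))))))

  Choice : Set
  Choice = (x : M) →
    ((u : M) → u ∈ₘ x → Σ M (λ w → w ∈ₘ u)) →
    ((u v w : M) → u ∈ₘ x → v ∈ₘ x → w ∈ₘ u → w ∈ₘ v → u ≡ v) →
    Σ M (λ c → (u : M) → u ∈ₘ x →
      Σ M (λ w → (w ∈ₘ u) × (w ∈ₘ c) ×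
        ((w' : M) → w' ∈ₘ u → w' ∈ₘ c → w' ≡ w)))

  SeparationX : Set
  SeparationX = {k : ℕ} (φ : Fm true (suc k)) (ρ : Fin k → M) (z : M) →
    Σ M (λ y → (x : M) → (x ∈ₘ y) ⇔ ((x ∈ₘ z) × Sat S X φ (x ∷ᵃ ρ)))

  CollectionX : Set
  CollectionX = {k : ℕ} (φ : Fm true (suc (suc k))) (ρ : Fin k → M) (a : M) →
    ((x : M) → x ∈ₘ a → Σ M (λ y → Sat S X φ (y ∷ᵃ (x ∷ᵃ ρ)))) →
    Σ M (λ b → (x : M) → x ∈ₘ a →
      Σ M (λ y → (y ∈ₘ b) × Sat S X φ (y ∷ᵃ (x ∷ᵃ ρ))))

  record ZFC[X] : Set where
    field
      ext   : Extensionality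
      found : Foundation
      pair  : Pairing
      union : Union
      pow   : PowerSet
      inf   : Infinity
      choice : Choice
      sep   : SeparationX
      coll  : CollectionX

-- ⟨M,∈^M⟩ ≺_cf N, with M identified with its image under e : M → N.
-- Elementarity is for L-formulae (the X-interpretation is irrelevant there).
record ElemCofinalExt (M N : LStr) : Set₁ where
  field
    e         : Carrier M → Carrier N
    elementary : {n : ℕ} (φ : Fm false n) (ρ : Fin n → Carrier M) →
      Sat M (λ _ → ⊥) φ ρ ⇔ Sat N (λ _ → ⊥) φ (λ i → e (ρ i))
    cofinal   : (x : Carrier N) → Σ (Carrier M) (λ y → mem N x (e y))

-- Put X^N(x) iff x ∈ e(s) for some s ∈ M with s ⊆ X^M.  By induction on φ, for every
-- b ∈ M there is an ∈-formula θ with parameters in M that agrees with φ on tuples from b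
-- in M and, simultaneously, on tuples from e(b) in N; elementarity of e then transfers θ.
-- The atom X(v) becomes v ∈ {z ∈ b : X z}.  For ∃y ψ, Collection (iterated over the free
-- variables) gives c ⊇ b containing witnesses of ∃y ψ(y, ρ) for all ρ from b.  In N a
-- witness y lies in some e(d) by cofinality.  Take d' ⊇ c ∪ d and the formula θ agreeing
-- with ψ on d': the statement "witnesses of θ in d' can be found in c" holds in M, is an
-- ∈-formula with parameters, and so holds in N, which brings y down into e(c).
module Submission where

open import Defs
open import Data.Nat using (ℕ; zero; suc; _+_)
open import Data.Fin using (Fin; zero; suc; _↑ˡ_; _↑ʳ_; lift)
open import Data.Bool using (Bool; true; false)
open import Data.Product using (Σ; ∃-syntax; _×_; _,_; proj₁; proj₂)
open import Data.Sum using (_⊎_; inj₁; inj₂)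
open import Data.Empty using (⊥; ⊥-elim)
open import Function using (_∘_; id)
open import Relation.Nullary using (¬_)
open import Relation.Binary.PropositionalEquality
  using (_≡_; _≗_; refl; sym; cong; cong₂; subst)

variable
  t : Bool
  n m k j : ℕ
  A B A' B' : Set

≡⇒⇔ : A ≡ B → A ⇔ B
≡⇒⇔ refl = id , id

⇔-refl : A ⇔ A
⇔-refl = id , id

⇔-sym : A ⇔ B → B ⇔ A
⇔-sym (f , g) = g , f

⇔-trans : {C : Set} → A ⇔ B → B ⇔ C → A ⇔ C
⇔-trans (f , g) (f' , g') = f' ∘ f , g ∘ g'

→-cong : A ⇔ A' → B ⇔ B' → (A → B) ⇔ (A' → B')
→-cong (f , g) (f' , g') = (λ h → f' ∘ h ∘ g) , (λ h → g' ∘ h ∘ f)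

×-cong : A ⇔ A' → B ⇔ B' → (A × B) ⇔ (A' × B')
×-cong (f , g) (f' , g') = (λ (a , b) → f a , f' b) , (λ (a , b) → g a , g' b)

⊎-cong : A ⇔ A' → B ⇔ B' → (A ⊎ B) ⇔ (A' ⊎ B')
⊎-cong (f , g) (f' , g') =
  (λ { (inj₁ a) → inj₁ (f a) ; (inj₂ b) → inj₂ (f' b) }) ,
  (λ { (inj₁ a) → inj₁ (g a) ; (inj₂ b) → inj₂ (g' b) })

Π-cong : {F G : A → Set} → (∀ a → F a ⇔ G a) → ((a : A) → F a) ⇔ ((a : A) → G a)
Π-cong h = (λ f a → proj₁ (h a) (f a)) , (λ g a → proj₂ (h a) (g a))

Σ-cong : {F G : A → Set} → (∀ a → F a ⇔ G a) → Σ A F ⇔ Σ A G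
Σ-cong h = (λ (a , x) → a , proj₁ (h a) x) , (λ (a , y) → a , proj₂ (h a) y)

bounded-Σ-cong : {R F G : A → Set} → (∀ a → R a → F a ⇔ G a) →
  Σ A (λ a → R a × F a) ⇔ Σ A (λ a → R a × G a)
bounded-Σ-cong h = (λ (a , r , x) → a , r , proj₁ (h a r) x) ,
                   (λ (a , r , y) → a , r , proj₂ (h a r) y)

module _ (lem : LEM) where
  ×-classical : (A × B) ⇔ (¬ (A → ¬ B))
  ×-classical {A} {B} = (λ (a , b) f → f a b) , from
    where
    from : ¬ (A → ¬ B) → A × B
    from g with lem A | lem B
    ... | inj₁ a  | inj₁ b  = a , b
    ... | inj₁ _  | inj₂ ¬b = ⊥-elim (g (λ _ → ¬b))
    ... | inj₂ ¬a | _       = ⊥-elim (g (⊥-elim ∘ ¬a))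

  ⊎-classical : (A ⊎ B) ⇔ (¬ A → B)
  ⊎-classical {A} = (λ { (inj₁ a) ¬a → ⊥-elim (¬a a) ; (inj₂ b) _ → b }) , from
    where
    from : (¬ A → B) → A ⊎ B
    from g with lem A
    ... | inj₁ a  = inj₁ a
    ... | inj₂ ¬a = inj₂ (g ¬a)

  Π-classical : {F : A → Set} → ((a : A) → F a) ⇔ (¬ Σ A (¬_ ∘ F))
  Π-classical {F = F} = (λ f (a , ¬Fa) → ¬Fa (f a)) , from
    where
    from : ¬ Σ _ (¬_ ∘ F) → (a : _) → F a
    from g a with lem (F a)
    ... | inj₁ Fa  = Fa
    ... | inj₂ ¬Fa = ⊥-elim (g (a , ¬Fa))

_++ᵃ_ : {C : Set} → (Fin n → C) → (Fin k → C) → Fin (n + k) → C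
_++ᵃ_ {n = zero}  ρ τ = τ
_++ᵃ_ {n = suc n} ρ τ = ρ zero ∷ᵃ ((ρ ∘ suc) ++ᵃ τ)

module _ {C : Set} where
  ++ᵃ-↑ˡ : (ρ : Fin n → C) (τ : Fin k → C) (i : Fin n) → (ρ ++ᵃ τ) (i ↑ˡ k) ≡ ρ i
  ++ᵃ-↑ˡ ρ τ zero    = refl
  ++ᵃ-↑ˡ ρ τ (suc i) = ++ᵃ-↑ˡ (ρ ∘ suc) τ i

  ++ᵃ-↑ʳ : (ρ : Fin n → C) (τ : Fin k → C) (i : Fin k) → (ρ ++ᵃ τ) (n ↑ʳ i) ≡ τ i
  ++ᵃ-↑ʳ {n = zero}  ρ τ i = refl
  ++ᵃ-↑ʳ {n = suc n} ρ τ i = ++ᵃ-↑ʳ (ρ ∘ suc) τ i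

  ++ᵃ-lift : (ρ : Fin n → C) {τ : Fin m → C} {σ : Fin k → C} (f : Fin k → Fin m) →
    (∀ i → τ (f i) ≡ σ i) → ∀ x → (ρ ++ᵃ τ) (lift n f x) ≡ (ρ ++ᵃ σ) x
  ++ᵃ-lift {n = zero}  ρ f h x       = h x
  ++ᵃ-lift {n = suc n} ρ f h zero    = refl
  ++ᵃ-lift {n = suc n} ρ f h (suc x) = ++ᵃ-lift (ρ ∘ suc) f h x

  ∷ᵃ-lift : {σ : Fin n → C} {τ : Fin m → C} (a : C) {f : Fin n → Fin m} →
    (∀ i → τ (f i) ≡ σ i) → ∀ i → (a ∷ᵃ τ) (lift 1 f i) ≡ (a ∷ᵃ σ) i
  ∷ᵃ-lift a h zero    = refl
  ∷ᵃ-lift a h (suc i) = h i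

map-++ᵃ : {C D : Set} (f : C → D) (ρ : Fin n → C) (τ : Fin k → C) →
  f ∘ (ρ ++ᵃ τ) ≗ (f ∘ ρ) ++ᵃ (f ∘ τ)
map-++ᵃ {n = zero}  f ρ τ x       = refl
map-++ᵃ {n = suc n} f ρ τ zero    = refl
map-++ᵃ {n = suc n} f ρ τ (suc x) = map-++ᵃ f (ρ ∘ suc) τ x

ren : (Fin n → Fin m) → Fm t n → Fm t m
ren f (i ∈' j) = f i ∈' f j
ren f (i ≐ j)  = f i ≐ f j
ren f (X' i)   = X' (f i)
ren f ⊥'       = ⊥'
ren f (φ ⇒ ψ)  = ren f φ ⇒ ren f ψ
ren f (φ ∧' ψ) = ren f φ ∧' ren f ψ
ren f (φ ∨' ψ) = ren f φ ∨' ren f ψ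
ren f (∀' φ)   = ∀' (ren (lift 1 f) φ)
ren f (∃' φ)   = ∃' (ren (lift 1 f) φ)

∀∈ⁿ : (n : ℕ) → Fin k → Fm t (n + k) → Fm t k
∀∈ⁿ zero    v φ = φ
∀∈ⁿ (suc n) v φ = ∀∈ⁿ n v (∀' ((zero ∈' suc (n ↑ʳ v)) ⇒ φ))

∃∈ : Fin k → Fm t (suc k) → Fm t k
∃∈ v φ = ∃' ((zero ∈' suc v) ∧' φ)

-- Formulas in context (y, ρ, π): y bound, ρ the n free variables, π the parameters.
-- shift inserts j new parameters κ, giving context (y, ρ, κ, π); ∃∈ᵖ bounds y by κ_w.
shift : (n j : ℕ) → Fm t (suc (n + k)) → Fm t (suc (n + (j + k)))
shift n j = ren (lift 1 (lift n (j ↑ʳ_)))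

∃∈ᵖ : (n : ℕ) → Fin j → Fm t (suc (n + k)) → Fm t (n + (j + k))
∃∈ᵖ {j = j} {k = k} n w θ = ∃∈ (n ↑ʳ (w ↑ˡ k)) (shift n j θ)

reflectsFm : (n : ℕ) → Fin k → Fm t (suc (n + k)) → Fm t (suc k)
reflectsFm n v ψ = ∀∈ⁿ n (suc v) (∃' (shift n 1 ψ) ⇒ ∃∈ᵖ n zero ψ)

shrinksFm : (n : ℕ) → Fm t (suc (n + k)) → Fm t (3 + k)
shrinksFm n θ = ∀∈ⁿ n zero (∃∈ᵖ n (suc (suc zero)) θ ⇒ ∃∈ᵖ n (suc zero) θ)

Sat∈ : (S : LStr) → Fm false n → (Fin n → Carrier S) → Set
Sat∈ S = Sat S (λ _ → ⊥)

module _ (S : LStr) where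
  private
    C : Set
    C = Carrier S

  Subset : C → C → Set
  Subset a b = (z : C) → mem S z a → mem S z b

  Within : C → (Fin n → C) → Set
  Within b ρ = ∀ i → mem S (ρ i) b

  Within-∷ : {ρ : Fin n → C} {b y : C} → mem S y b → Within b ρ → Within b (y ∷ᵃ ρ)
  Within-∷ y∈b ρ∈b zero    = y∈b
  Within-∷ y∈b ρ∈b (suc i) = ρ∈b i

  Within-mono : {ρ : Fin n → C} {b c : C} → Subset b c → Within b ρ → Within c ρ
  Within-mono b⊆c ρ∈b i = b⊆c _ (ρ∈b i)

  Reflects : ((Fin n → C) → C → Set) → C → C → Set
  Reflects F b c = (ρ : Fin _ → C) → Within b ρ → ∃[ y ] F ρ y → ∃[ y ] (mem S y c × F ρ y)

  Shrinks : ((Fin n → C) → C → Set) → C → C → C → Set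
  Shrinks F b c d = (ρ : Fin _ → C) → Within b ρ →
    ∃[ y ] (mem S y d × F ρ y) → ∃[ y ] (mem S y c × F ρ y)

  module _ {F : (Fin n → C) → C → Set} {b : C} where
    Reflects-mono : {c c' : C} → Subset c c' → Reflects F b c → Reflects F b c'
    Reflects-mono c⊆c' r ρ ρ∈b w with r ρ ρ∈b w
    ... | y , y∈c , Fy = y , c⊆c' y y∈c , Fy

    Reflects⇒Shrinks : {c d : C} → Reflects F b c → Shrinks F b c d
    Reflects⇒Shrinks r ρ ρ∈b (y , _ , Fy) = r ρ ρ∈b (y , Fy)

    reflects-⇔ : {c : C} {ρ : Fin n → C} → Reflects F b c → Within b ρ →
      (∃[ y ] F ρ y) ⇔ (∃[ y ] (mem S y c × F ρ y))
    reflects-⇔ r ρ∈b = r _ ρ∈b , λ (y , _ , Fy) → y , Fy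

    module _ {G : (Fin n → C) → C → Set} where
      Reflects-cong : {c : C} → (∀ ρ y → F ρ y ⇔ G ρ y) → Reflects F b c → Reflects G b c
      Reflects-cong h r ρ ρ∈b (y , Gy) with r ρ ρ∈b (y , proj₂ (h ρ y) Gy)
      ... | y' , y'∈c , Fy' = y' , y'∈c , proj₁ (h ρ y') Fy'

      Shrinks-cong : {c d : C} → Subset c d →
        (∀ ρ → Within b ρ → ∀ y → mem S y d → F ρ y ⇔ G ρ y) → Shrinks F b c d → Shrinks G b c d
      Shrinks-cong c⊆d h s ρ ρ∈b (y , y∈d , Gy) with s ρ ρ∈b (y , y∈d , proj₂ (h ρ ρ∈b y y∈d) Gy)
      ... | y' , y'∈c , Fy' = y' , y'∈c , proj₁ (h ρ ρ∈b y' (c⊆d y' y'∈c)) Fy'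

module Semantics (S : LStr) (P : Carrier S → Set) where
  private
    C : Set
    C = Carrier S

  Sat-ren : (f : Fin n → Fin m) (φ : Fm t n) {σ : Fin m → C} {τ : Fin n → C} →
    (∀ i → σ (f i) ≡ τ i) → Sat S P (ren f φ) σ ⇔ Sat S P φ τ
  Sat-ren f (i ∈' j) h = ≡⇒⇔ (cong₂ (mem S) (h i) (h j))
  Sat-ren f (i ≐ j)  h = ≡⇒⇔ (cong₂ _≡_ (h i) (h j))
  Sat-ren f (X' i)   h = ≡⇒⇔ (cong P (h i))
  Sat-ren f ⊥'       h = ⇔-refl
  Sat-ren f (φ ⇒ ψ)  h = →-cong (Sat-ren f φ h) (Sat-ren f ψ h)
  Sat-ren f (φ ∧' ψ) h = ×-cong (Sat-ren f φ h) (Sat-ren f ψ h)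
  Sat-ren f (φ ∨' ψ) h = ⊎-cong (Sat-ren f φ h) (Sat-ren f ψ h)
  Sat-ren f (∀' φ)   h = Π-cong λ a → Sat-ren (lift 1 f) φ (∷ᵃ-lift a h)
  Sat-ren f (∃' φ)   h = Σ-cong λ a → Sat-ren (lift 1 f) φ (∷ᵃ-lift a h)

  Sat-cong : (φ : Fm t n) {σ τ : Fin n → C} → σ ≗ τ → Sat S P φ σ ⇔ Sat S P φ τ
  Sat-cong φ h = ⇔-trans (⇔-sym (Sat-ren id φ λ _ → refl)) (Sat-ren id φ h)

  Sat-∀∈ⁿ : (n : ℕ) (v : Fin k) (φ : Fm t (n + k)) (τ : Fin k → C) →
    Sat S P (∀∈ⁿ n v φ) τ ⇔ ((ρ : Fin n → C) → Within S (τ v) ρ → Sat S P φ (ρ ++ᵃ τ))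
  Sat-∀∈ⁿ zero    v φ τ = (λ s _ _ → s) , (λ h → h (λ ()) (λ ()))
  Sat-∀∈ⁿ (suc n) v φ τ = to , from
    where
    IH = Sat-∀∈ⁿ n v (∀' ((zero ∈' suc (n ↑ʳ v)) ⇒ φ)) τ
    to : Sat S P (∀∈ⁿ (suc n) v φ) τ →
      (ρ : Fin (suc n) → C) → Within S (τ v) ρ → Sat S P φ (ρ ++ᵃ τ)
    to s ρ ρ∈ = proj₁ IH s (ρ ∘ suc) (ρ∈ ∘ suc) (ρ zero)
      (subst (mem S (ρ zero)) (sym (++ᵃ-↑ʳ (ρ ∘ suc) τ v)) (ρ∈ zero))
    from : ((ρ : Fin (suc n) → C) → Within S (τ v) ρ → Sat S P φ (ρ ++ᵃ τ)) →
      Sat S P (∀∈ⁿ (suc n) v φ) τ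
    from g = proj₂ IH λ ρ ρ∈ a a∈ →
      g (a ∷ᵃ ρ) (Within-∷ S (subst (mem S a) (++ᵃ-↑ʳ ρ τ v) a∈) ρ∈)

  Sat-shift : (j : ℕ) (θ : Fm t (suc (n + k))) (y : C) (ρ : Fin n → C)
    {τ : Fin (j + k) → C} {π : Fin k → C} → (∀ i → τ (j ↑ʳ i) ≡ π i) →
    Sat S P (shift n j θ) (y ∷ᵃ (ρ ++ᵃ τ)) ⇔ Sat S P θ (y ∷ᵃ (ρ ++ᵃ π))
  Sat-shift j θ y ρ h = Sat-ren _ θ (∷ᵃ-lift y (++ᵃ-lift ρ (j ↑ʳ_) h))

  Sat-∃∈ᵖ : (w : Fin j) (θ : Fm t (suc (n + k))) (ρ : Fin n → C)
    {τ : Fin (j + k) → C} {π : Fin k → C} → (∀ i → τ (j ↑ʳ i) ≡ π i) →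
    Sat S P (∃∈ᵖ n w θ) (ρ ++ᵃ τ) ⇔ (∃[ y ] (mem S y (τ (w ↑ˡ k)) × Sat S P θ (y ∷ᵃ (ρ ++ᵃ π))))
  Sat-∃∈ᵖ {j = j} {k = k} w θ ρ {τ} h = Σ-cong λ y →
    ×-cong (≡⇒⇔ (cong (mem S y) (++ᵃ-↑ʳ ρ τ (w ↑ˡ k)))) (Sat-shift j θ y ρ h)

  Sat-reflectsFm : (ψ : Fm t (suc (n + k))) (v : Fin k) (c : C) (π : Fin k → C) →
    Sat S P (reflectsFm n v ψ) (c ∷ᵃ π) ⇔
      Reflects S (λ ρ y → Sat S P ψ (y ∷ᵃ (ρ ++ᵃ π))) (π v) c
  Sat-reflectsFm {n = n} ψ v c π =
    ⇔-trans (Sat-∀∈ⁿ n (suc v) _ (c ∷ᵃ π)) (Π-cong λ ρ → →-cong ⇔-refl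
      (→-cong (Σ-cong λ y → Sat-shift 1 ψ y ρ λ _ → refl) (Sat-∃∈ᵖ zero ψ ρ λ _ → refl)))

  Sat-shrinksFm : (θ : Fm t (suc (n + k))) (τ : Fin (3 + k) → C) (π : Fin k → C) →
    (∀ i → τ (3 ↑ʳ i) ≡ π i) →
    Sat S P (shrinksFm n θ) τ ⇔
      Shrinks S (λ ρ y → Sat S P θ (y ∷ᵃ (ρ ++ᵃ π))) (τ zero) (τ (suc zero)) (τ (suc (suc zero)))
  Sat-shrinksFm {n = n} θ τ π h =
    ⇔-trans (Sat-∀∈ⁿ n zero _ τ) (Π-cong λ ρ → →-cong ⇔-refl
      (→-cong (Sat-∃∈ᵖ (suc (suc zero)) θ ρ h) (Sat-∃∈ᵖ (suc zero) θ ρ h)))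

module Extension (lem : LEM) (M : LStr) (XM : Carrier M → Set) (Z : ZFC[X] M XM)
                 (N : LStr) (E : ElemCofinalExt M N) where
  open ZFC[X] Z
  open ElemCofinalExt E

  infix 4 _∈ᴹ_ _∈ᴺ_ _⊆ᴹ_
  private
    CM CN : Set
    CM = Carrier M
    CN = Carrier N

    _∈ᴹ_ : CM → CM → Set
    _∈ᴹ_ = mem M

    _∈ᴺ_ : CN → CN → Set
    _∈ᴺ_ = mem N

    _⊆ᴹ_ : CM → CM → Set
    _⊆ᴹ_ = Subset M

  XN : CN → Set
  XN x = ∃[ s ] (((z : CM) → z ∈ᴹ s → XM z) × x ∈ᴺ e s)

  module MX = Semantics M XM
  module M∈ = Semantics M (λ _ → ⊥)
  module N∈ = Semantics N (λ _ → ⊥)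

  e-∈ : {a a' : CM} → a ∈ᴹ a' → e a ∈ᴺ e a'
  e-∈ {a} {a'} = proj₁ (elementary {2} (zero ∈' suc zero) (a ∷ᵃ (a' ∷ᵃ λ ())))

  e-⊆ : {a a' : CM} → a ⊆ᴹ a' → Subset N (e a) (e a')
  e-⊆ {a} {a'} = proj₁ (elementary {2} (∀' ((zero ∈' suc zero) ⇒ (zero ∈' suc (suc zero))))
                                   (a ∷ᵃ (a' ∷ᵃ λ ())))

  e-∩⊆ : {a a' a'' : CM} → ((z : CM) → z ∈ᴹ a → z ∈ᴹ a' → z ∈ᴹ a'') →
    (z : CN) → z ∈ᴺ e a → z ∈ᴺ e a' → z ∈ᴺ e a''
  e-∩⊆ {a} {a'} {a''} = proj₁ (elementary {3}
    (∀' ((zero ∈' suc zero) ⇒ ((zero ∈' suc (suc zero)) ⇒ (zero ∈' suc (suc (suc zero))))))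
    (a ∷ᵃ (a' ∷ᵃ (a'' ∷ᵃ λ ()))))

  transfer : (θ : Fm false (n + k)) (ρ : Fin n → CM) (π : Fin k → CM) →
    Sat∈ M θ (ρ ++ᵃ π) ⇔ Sat∈ N θ ((e ∘ ρ) ++ᵃ (e ∘ π))
  transfer θ ρ π = ⇔-trans (elementary θ (ρ ++ᵃ π)) (N∈.Sat-cong θ (map-++ᵃ e ρ π))

  upper-bound : (a a' : CM) → ∃[ u ] (a ⊆ᴹ u × a' ⊆ᴹ u)
  upper-bound a a' with pair a a'
  ... | p , a∈p , a'∈p with union p
  ... | u , ⋃p = u , (λ z z∈a → ⋃p z a z∈a a∈p) , (λ z z∈a' → ⋃p z a' z∈a' a'∈p)

  bounding-set : (ρ : Fin n → CM) → ∃[ b ] Within M b ρ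
  bounding-set {zero}  ρ = proj₁ inf , λ ()
  bounding-set {suc n} ρ with bounding-set (ρ ∘ suc) | pair (ρ zero) (ρ zero)
  ... | b , ρ∈b | p , ρ₀∈p , _ with upper-bound b p
  ... | u , b⊆u , p⊆u = u , λ { zero → p⊆u _ ρ₀∈p ; (suc i) → b⊆u _ (ρ∈b i) }

  separateX : (b : CM) → ∃[ s ] ((z : CM) → (z ∈ᴹ s) ⇔ (z ∈ᴹ b × XM z))
  separateX = sep {0} (X' zero) (λ ())

  XM⊆XN : (m : CM) → XM m → XN (e m)
  XM⊆XN m Xm with pair m m
  ... | p , m∈p , _ with separateX p
  ... | s , s-def = s , (λ z z∈s → proj₂ (proj₁ (s-def z) z∈s)) , e-∈ (proj₂ (s-def m) (m∈p , Xm))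

  -- Collection, applied once for each of the n bounded variables.
  reflection : (n : ℕ) (ψ : Fm true (suc (n + m))) (σ : Fin m → CM) (b : CM) →
    ∃[ c ] Reflects M (λ ρ y → Sat M XM ψ (y ∷ᵃ (ρ ++ᵃ σ))) b c
  reflection zero ψ σ b with lem (∃[ y ] Sat M XM ψ (y ∷ᵃ σ))
  ... | inj₂ none    = b , λ _ _ w → ⊥-elim (none w)
  ... | inj₁ (y , s) with pair y y
  ...   | p , y∈p , _ = p , λ _ _ _ → y , y∈p , s
  reflection {m} (suc n) ψ σ b = c , reflects
    where
    -- the first bounded variable x becomes a parameter, next to b
    h : Fin (suc (n + m)) → Fin (n + suc (suc m))
    h = (n ↑ʳ zero) ∷ᵃ lift n (λ j → suc (suc j))

    ψ' : Fm true (suc (n + suc (suc m)))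
    ψ' = ren (lift 1 h) ψ

    ψ'-meaning : (x : CM) (ρ : Fin n → CM) (y : CM) →
      Sat M XM ψ' (y ∷ᵃ (ρ ++ᵃ (x ∷ᵃ (b ∷ᵃ σ)))) ⇔ Sat M XM ψ (y ∷ᵃ (x ∷ᵃ (ρ ++ᵃ σ)))
    ψ'-meaning x ρ y = MX.Sat-ren (lift 1 h) ψ (∷ᵃ-lift y h-meaning)
      where
      h-meaning : ∀ i → (ρ ++ᵃ (x ∷ᵃ (b ∷ᵃ σ))) (h i) ≡ (x ∷ᵃ (ρ ++ᵃ σ)) i
      h-meaning zero    = ++ᵃ-↑ʳ ρ _ zero
      h-meaning (suc i) = ++ᵃ-lift ρ (λ j → suc (suc j)) (λ _ → refl) i

    Φ : Fm true (suc (suc (suc m)))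
    Φ = reflectsFm n (suc zero) ψ'

    bound-for : (x : CM) → ∃[ u ] Sat M XM Φ (u ∷ᵃ (x ∷ᵃ (b ∷ᵃ σ)))
    bound-for x with reflection n ψ' (x ∷ᵃ (b ∷ᵃ σ)) b
    ... | u , r = u , proj₂ (MX.Sat-reflectsFm ψ' (suc zero) u _) r

    collected : ∃[ B ] ((x : CM) → x ∈ᴹ b → ∃[ u ] (u ∈ᴹ B × Sat M XM Φ (u ∷ᵃ (x ∷ᵃ (b ∷ᵃ σ)))))
    collected = coll Φ (b ∷ᵃ σ) b (λ x _ → bound-for x)

    ⋃collected : ∃[ c ] ((z u : CM) → z ∈ᴹ u → u ∈ᴹ proj₁ collected → z ∈ᴹ c)
    ⋃collected = union (proj₁ collected)

    c : CM
    c = proj₁ ⋃collected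

    reflects : Reflects M (λ ρ y → Sat M XM ψ (y ∷ᵃ (ρ ++ᵃ σ))) b c
    reflects ρ ρ∈b w with proj₂ collected (ρ zero) (ρ∈b zero)
    ... | u , u∈B , Φu
      with Reflects-cong M (ψ'-meaning (ρ zero)) (proj₁ (MX.Sat-reflectsFm ψ' (suc zero) u _) Φu)
             (ρ ∘ suc) (ρ∈b ∘ suc) w
    ... | y , y∈u , s = y , proj₂ ⋃collected y u y∈u u∈B , s

  witness-bound : (ψ : Fm true (suc n)) (b : CM) →
    ∃[ c ] (b ⊆ᴹ c × Reflects M (λ ρ y → Sat M XM ψ (y ∷ᵃ ρ)) b c)
  witness-bound {n} ψ b with reflection n (ren (lift 1 (_↑ˡ 0)) ψ) (λ ()) b
  ... | c₀ , r with upper-bound b c₀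
  ... | c , b⊆c , c₀⊆c = c , b⊆c ,
    Reflects-mono M c₀⊆c
      (Reflects-cong M (λ ρ y → MX.Sat-ren (lift 1 (_↑ˡ 0)) ψ (∷ᵃ-lift y (++ᵃ-↑ˡ ρ _))) r)

  record Reduct (φ : Fm true n) (b : CM) : Set where
    field
      arity   : ℕ
      params  : Fin arity → CM
      formula : Fm false (n + arity)
      in-M    : (ρ : Fin n → CM) → Within M b ρ →
                Sat M XM φ ρ ⇔ Sat∈ M formula (ρ ++ᵃ params)
      in-N    : (ρ : Fin n → CN) → Within N (e b) ρ →
                Sat N XN φ ρ ⇔ Sat∈ N formula (ρ ++ᵃ (e ∘ params))
  open Reduct

  reduct-resp : {φ φ' : Fm true n} {b : CM} →
    (∀ ρ → Sat M XM φ ρ ⇔ Sat M XM φ' ρ) → (∀ ρ → Sat N XN φ ρ ⇔ Sat N XN φ' ρ) →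
    Reduct φ' b → Reduct φ b
  reduct-resp hM hN R = record
    { arity = arity R ; params = params R ; formula = formula R
    ; in-M  = λ ρ ρ∈b → ⇔-trans (hM ρ) (in-M R ρ ρ∈b)
    ; in-N  = λ ρ ρ∈b → ⇔-trans (hN ρ) (in-N R ρ ρ∈b)
    }

  reduct-parameterFree : {φ : Fm true n} {b : CM} (θ : Fm false n) →
    (∀ ρ → Sat M XM φ ρ ⇔ Sat∈ M θ ρ) → (∀ ρ → Sat N XN φ ρ ⇔ Sat∈ N θ ρ) → Reduct φ b
  reduct-parameterFree θ hM hN = record
    { arity = 0 ; params = λ () ; formula = ren (_↑ˡ 0) θ
    ; in-M  = λ ρ _ → ⇔-trans (hM ρ) (⇔-sym (M∈.Sat-ren (_↑ˡ 0) θ (++ᵃ-↑ˡ ρ _)))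
    ; in-N  = λ ρ _ → ⇔-trans (hN ρ) (⇔-sym (N∈.Sat-ren (_↑ˡ 0) θ (++ᵃ-↑ˡ ρ _)))
    }

  reduct-⊥ : {b : CM} → Reduct {n} ⊥' b
  reduct-⊥ = reduct-parameterFree ⊥' (λ _ → ⇔-refl) (λ _ → ⇔-refl)

  reduct-X : (i : Fin n) (b : CM) → Reduct (X' i) b
  reduct-X {n} i b = record
    { arity = 1 ; params = λ _ → s ; formula = (i ↑ˡ 1) ∈' (n ↑ʳ zero)
    ; in-M  = λ ρ ρ∈b → ⇔-trans (X-in-M (ρ i) (ρ∈b i))
                (≡⇒⇔ (sym (cong₂ (mem M) (++ᵃ-↑ˡ ρ _ i) (++ᵃ-↑ʳ ρ _ zero))))
    ; in-N  = λ ρ ρ∈b → ⇔-trans (X-in-N (ρ i) (ρ∈b i))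
                (≡⇒⇔ (sym (cong₂ (mem N) (++ᵃ-↑ˡ ρ _ i) (++ᵃ-↑ʳ ρ _ zero))))
    }
    where
    s : CM
    s = proj₁ (separateX b)

    s⊆X : (z : CM) → z ∈ᴹ s → XM z
    s⊆X z z∈s = proj₂ (proj₁ (proj₂ (separateX b) z) z∈s)

    X-in-M : (z : CM) → z ∈ᴹ b → XM z ⇔ (z ∈ᴹ s)
    X-in-M z z∈b = (λ Xz → proj₂ (proj₂ (separateX b) z) (z∈b , Xz)) , s⊆X z

    X-in-N : (z : CN) → z ∈ᴺ e b → XN z ⇔ (z ∈ᴺ e s)
    X-in-N z z∈eb =
      (λ (s' , s'⊆X , z∈es') →
         e-∩⊆ (λ x x∈s' x∈b → proj₂ (proj₂ (separateX b) x) (x∈b , s'⊆X x x∈s')) z z∈es' z∈eb) ,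
      (λ z∈es → s , s⊆X , z∈es)

  reduct-⇒ : {φ ψ : Fm true n} {b : CM} → Reduct φ b → Reduct ψ b → Reduct (φ ⇒ ψ) b
  reduct-⇒ {n} Rφ Rψ = record
    { arity   = k₁ + k₂
    ; params  = π₁ ++ᵃ π₂
    ; formula = ren (lift n (_↑ˡ k₂)) θ₁ ⇒ ren (lift n (k₁ ↑ʳ_)) θ₂
    ; in-M    = λ ρ ρ∈b →
        →-cong (⇔-trans (in-M Rφ ρ ρ∈b)
                  (⇔-sym (M∈.Sat-ren _ θ₁ (++ᵃ-lift ρ _ (++ᵃ-↑ˡ π₁ π₂)))))
               (⇔-trans (in-M Rψ ρ ρ∈b)
                  (⇔-sym (M∈.Sat-ren _ θ₂ (++ᵃ-lift ρ _ (++ᵃ-↑ʳ π₁ π₂)))))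
    ; in-N    = λ ρ ρ∈b →
        →-cong (⇔-trans (in-N Rφ ρ ρ∈b)
                  (⇔-sym (N∈.Sat-ren _ θ₁ (++ᵃ-lift ρ _ (cong e ∘ ++ᵃ-↑ˡ π₁ π₂)))))
               (⇔-trans (in-N Rψ ρ ρ∈b)
                  (⇔-sym (N∈.Sat-ren _ θ₂ (++ᵃ-lift ρ _ (cong e ∘ ++ᵃ-↑ʳ π₁ π₂)))))
    }
    where
    k₁ k₂ : ℕ
    k₁ = arity Rφ
    k₂ = arity Rψ

    π₁ : Fin k₁ → CM
    π₁ = params Rφ

    π₂ : Fin k₂ → CM
    π₂ = params Rψ

    θ₁ : Fm false (n + k₁)
    θ₁ = formula Rφ

    θ₂ : Fm false (n + k₂)
    θ₂ = formula Rψ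

  reduct-¬ : {φ : Fm true n} {b : CM} → Reduct φ b → Reduct (φ ⇒ ⊥') b
  reduct-¬ R = reduct-⇒ R reduct-⊥

  shrinks-transfer : (θ : Fm false (suc (n + k))) (π : Fin k → CM) {b c d : CM} →
    Shrinks M (λ ρ y → Sat∈ M θ (y ∷ᵃ (ρ ++ᵃ π))) b c d →
    Shrinks N (λ ρ y → Sat∈ N θ (y ∷ᵃ (ρ ++ᵃ (e ∘ π)))) (e b) (e c) (e d)
  shrinks-transfer {n = n} {k = k} θ π {b} {c} {d} =
    proj₁ (N∈.Sat-shrinksFm θ (e ∘ τ) (e ∘ π) λ _ → refl) ∘
    proj₁ (elementary (shrinksFm n θ) τ) ∘
    proj₂ (M∈.Sat-shrinksFm θ τ π λ _ → refl)
    where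
    τ : Fin (3 + k) → CM
    τ = b ∷ᵃ (c ∷ᵃ (d ∷ᵃ π))

  reflection-in-N : {ψ : Fm true (suc n)} → ((d : CM) → Reduct ψ d) → {b c : CM} → b ⊆ᴹ c →
    Reflects M (λ ρ y → Sat M XM ψ (y ∷ᵃ ρ)) b c →
    Reflects N (λ ρ y → Sat N XN ψ (y ∷ᵃ ρ)) (e b) (e c)
  reflection-in-N {ψ = ψ} R {b} {c} b⊆c reflects ρ ρ∈eb (y , ψy) with cofinal y
  ... | d , y∈ed with upper-bound c d
  ... | d' , c⊆d' , d⊆d' = shrinks ρ ρ∈eb (y , e-⊆ d⊆d' y y∈ed , ψy)
    where
    b⊆d' : b ⊆ᴹ d'
    b⊆d' z = c⊆d' z ∘ b⊆c z

    shrinks : Shrinks N (λ ρ y → Sat N XN ψ (y ∷ᵃ ρ)) (e b) (e c) (e d')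
    shrinks =
      Shrinks-cong N (e-⊆ c⊆d')
        (λ ρ ρ∈ y y∈ → ⇔-sym (in-N (R d') (y ∷ᵃ ρ) (Within-∷ N y∈ (Within-mono N (e-⊆ b⊆d') ρ∈))))
        (shrinks-transfer (formula (R d')) (params (R d'))
          (Shrinks-cong M c⊆d'
            (λ ρ ρ∈ y y∈ → in-M (R d') (y ∷ᵃ ρ) (Within-∷ M y∈ (Within-mono M b⊆d' ρ∈)))
            (Reflects⇒Shrinks M reflects)))

  reduct-∃ : {ψ : Fm true (suc n)} → ((b : CM) → Reduct ψ b) → (b : CM) → Reduct (∃' ψ) b
  reduct-∃ {n} {ψ} R b = record
    { arity   = suc (arity Rc)
    ; params  = c ∷ᵃ params Rc
    ; formula = ∃∈ᵖ n zero (formula Rc)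
    ; in-M    = λ ρ ρ∈b → ⇔-trans (reflects-⇔ M c-reflects ρ∈b)
        (⇔-trans (bounded-Σ-cong λ y y∈c →
                    in-M Rc (y ∷ᵃ ρ) (Within-∷ M y∈c (Within-mono M b⊆c ρ∈b)))
                 (⇔-sym (M∈.Sat-∃∈ᵖ zero (formula Rc) ρ λ _ → refl)))
    ; in-N    = λ ρ ρ∈eb → ⇔-trans (reflects-⇔ N (reflection-in-N R b⊆c c-reflects) ρ∈eb)
        (⇔-trans (bounded-Σ-cong λ y y∈ec →
                    in-N Rc (y ∷ᵃ ρ) (Within-∷ N y∈ec (Within-mono N (e-⊆ b⊆c) ρ∈eb)))
                 (⇔-sym (N∈.Sat-∃∈ᵖ zero (formula Rc) ρ λ _ → refl)))
    }
    where
    c : CM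
    c = proj₁ (witness-bound ψ b)

    b⊆c : b ⊆ᴹ c
    b⊆c = proj₁ (proj₂ (witness-bound ψ b))

    c-reflects : Reflects M (λ ρ y → Sat M XM ψ (y ∷ᵃ ρ)) b c
    c-reflects = proj₂ (proj₂ (witness-bound ψ b))

    Rc : Reduct ψ c
    Rc = R c

  reduct : (φ : Fm true n) (b : CM) → Reduct φ b
  reduct (i ∈' j) b = reduct-parameterFree (i ∈' j) (λ _ → ⇔-refl) (λ _ → ⇔-refl)
  reduct (i ≐ j)  b = reduct-parameterFree (i ≐ j) (λ _ → ⇔-refl) (λ _ → ⇔-refl)
  reduct (X' i)   b = reduct-X i b
  reduct ⊥'       b = reduct-⊥
  reduct (φ ⇒ ψ)  b = reduct-⇒ (reduct φ b) (reduct ψ b)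
  reduct (φ ∧' ψ) b = reduct-resp (λ _ → ×-classical lem) (λ _ → ×-classical lem)
    (reduct-¬ (reduct-⇒ (reduct φ b) (reduct-¬ (reduct ψ b))))
  reduct (φ ∨' ψ) b = reduct-resp (λ _ → ⊎-classical lem) (λ _ → ⊎-classical lem)
    (reduct-⇒ (reduct-¬ (reduct φ b)) (reduct ψ b))
  reduct (∀' φ)   b = reduct-resp (λ _ → Π-classical lem) (λ _ → Π-classical lem)
    (reduct-¬ (reduct-∃ (λ b' → reduct-¬ (reduct φ b')) b))
  reduct (∃' φ)   b = reduct-∃ (reduct φ) b

  preserves : (φ : Fm true n) (ρ : Fin n → CM) → Sat M XM φ ρ ⇔ Sat N XN φ (e ∘ ρ)
  preserves φ ρ with bounding-set ρ
  ... | b , ρ∈b = ⇔-trans (in-M R ρ ρ∈b)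
                    (⇔-trans (transfer (formula R) ρ (params R))
                             (⇔-sym (in-N R (e ∘ ρ) (λ i → e-∈ (ρ∈b i)))))
    where
    R : Reduct φ b
    R = reduct φ b

theorem6p3 : LEM → (M : LStr) (XM : Carrier M → Set) → ZFC[X] M XM →
    (N : LStr) (E : ElemCofinalExt M N) →
    Σ (Carrier N → Set) (λ XN →
      ((m : Carrier M) → XM m → XN (ElemCofinalExt.e E m)) ×
      ({n : ℕ} (φ : Fm true n) (ρ : Fin n → Carrier M) →
        Sat M XM φ ρ ⇔ Sat N XN φ (λ i → ElemCofinalExt.e E (ρ i))))
theorem6p3 lem M XM Z N E = XN , XM⊆XN , preserves
  where open Extension lem M XM Z N E
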